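{- For all $k\ge 1$ and $n\ge 4$, \[ F(A_{n+1},f_n) = F(A_{n+k},f_n). \]
   Context: Words are finite sequences over $\{0,1\}$; for sets of words $UV=\{uv:u\in U,v\in V\}$. Define $A_1=\{0\}$, $A_2=\{1\}$ and for $n\ge3$, $A_n=A_{n-1}A_{n-2}\cup A_{n-2}A_{n-1}$. All words of $A_n$ have common length $f_n$ (Fibonacci numbers, $f_1=f_2=1$, $f_n=f_{n-1}+f_{n-2}$). A word $x$ is a factor of $w$ if $w=uxv$ for some (possibly empty) words $u,v$. For a set of words $S$ and $m\ge1$, $F(S,m)$ is the set of all factors of length $m$ of words in $S$. -}

module Defs where

open import Data.Nat using (ℕ; zero; suc; _+_)
open import Data.Bool using (Bool; false; true)
open import Data.List using (List; []; _∷_; _++_; length)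
open import Data.Product using (Σ; ∃; _×_; _,_)
open import Relation.Binary.PropositionalEquality using (_≡_)

-- Words over {0,1}: 0 = false, 1 = true.
Word : Set
Word = List Bool

-- Fibonacci numbers, indexed from 1: fib 1 = 1, fib 2 = 1 (fib 0 = 0).
fib : ℕ → ℕ
fib zero = zero
fib (suc zero) = suc zero
fib (suc (suc n)) = fib (suc n) + fib n

-- Membership in A_n (n ≥ 1); A_0 is empty (not used by the paper).
-- A_1 = {0}, A_2 = {1}, A_{n+2} = A_{n+1} A_n ∪ A_n A_{n+1}.
data A : ℕ → Word → Set where
  a1 : A 1 (false ∷ [])
  a2 : A 2 (true ∷ [])
  aL : ∀ {n u v} → A (suc n) u → A n v → A (suc (suc n)) (u ++ v)
  aR : ∀ {n u v} → A n u → A (suc n) v → A (suc (suc n)) (u ++ v)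

Factor : Word → Word → Set
Factor x w = Σ Word λ u → Σ Word λ v → w ≡ u ++ x ++ v

F : (Word → Set) → ℕ → Word → Set
F S m x = length x ≡ m × (Σ Word λ w → S w × Factor x w)

_≐_ : (Word → Set) → (Word → Set) → Set
P ≐ Q = (∀ x → P x → Q x) × (∀ x → Q x → P x)
infix 4 _≐_

-- Going up is easy: a word of A (n+1) is a prefix of a word of A (n+2).  Going down, take a
-- factor x with |x| ≤ f_n of w = u v ∈ A_{n+1} A_n (the case A_n A_{n+1} follows by reversal,
-- which preserves every A_j).  If x lies in u we are done, and if it lies in v it lies in a word
-- of A_n A_{n-1} ⊆ A_{n+1}.  Otherwise x = s p straddles the cut.  The key fact is that a suffix
-- (dually, prefix) of a word of A_{j+1} of length < f_j is already a suffix of a word of A_j; so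
-- if |s| < f_{n-1} then s p straddles a word of A_{n-1} A_n, and otherwise |p| ≤ f_{n-2} < f_{n-1}
-- and s p straddles a word of A_n A_{n-1}.  Both lie in A_{n+1}.
module Submission where

open import Defs
open import Data.Nat
  using (ℕ; zero; suc; _+_; _≤_; _<_; _≤′_; ≤′-reflexive; ≤′-step; z≤n; s≤s; _<?_)
open import Data.Nat.Properties
open import Data.List using (List; []; _∷_; _++_; length; reverse)
open import Data.List.Properties
  using (∷-injective; length-++; ++-assoc; ++-identityʳ; reverse-++; reverse-involutive; length-reverse)
open import Data.Product using (Σ; _×_; _,_)
open import Data.Sum using (_⊎_; inj₁; inj₂)
open import Data.Empty using (⊥-elim)
open import Function using (_∘_)
open import Relation.Nullary using (yes; no)
open import Relation.Binary.PropositionalEquality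

++-equidivisible : ∀ {a} {X : Set a} (u v x y : List X) → u ++ v ≡ x ++ y →
  (Σ (List X) λ t → x ≡ u ++ t × v ≡ t ++ y) ⊎ (Σ (List X) λ t → u ≡ x ++ t × y ≡ t ++ v)
++-equidivisible [] v x y eq = inj₁ (x , refl , eq)
++-equidivisible (c ∷ u) v [] y eq = inj₂ (c ∷ u , refl , sym eq)
++-equidivisible (c ∷ u) v (d ∷ x) y eq with ∷-injective eq
... | refl , eq′ with ++-equidivisible u v x y eq′
...   | inj₁ (t , x≡ut , v≡ty) = inj₁ (t , cong (c ∷_) x≡ut , v≡ty)
...   | inj₂ (t , u≡xt , y≡tv) = inj₂ (t , cong (c ∷_) u≡xt , y≡tv)

Suffix : Word → Word → Set
Suffix s w = Σ Word λ r → w ≡ r ++ s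

Prefix : Word → Word → Set
Prefix p w = Σ Word λ c → w ≡ p ++ c

suffix-++ˡ : ∀ z {s v} → Suffix s v → Suffix s (z ++ v)
suffix-++ˡ z (t , refl) = z ++ t , sym (++-assoc z t _)

suffix-++ʳ : ∀ {t z} v → Suffix t z → Suffix (t ++ v) (z ++ v)
suffix-++ʳ v (r , refl) = r , ++-assoc r _ v

suffix⇒factor : ∀ {s w} → Suffix s w → Factor s w
suffix⇒factor {s} (r , refl) = r , [] , cong (r ++_) (sym (++-identityʳ s))

factor-++ʳ : ∀ {x v} z → Factor x v → Factor x (v ++ z)
factor-++ʳ {x} z (a , b , refl) = a , b ++ z ,
  trans (++-assoc a (x ++ b) z) (cong (a ++_) (++-assoc x b z))

factor-join : ∀ {s z p y} → Suffix s z → Prefix p y → Factor (s ++ p) (z ++ y)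
factor-join {s} {p = p} (r , refl) (c , refl) = r , c ,
  trans (++-assoc r s (p ++ c)) (cong (r ++_) (sym (++-assoc s p c)))

factor-++⁻ : ∀ u v {x} → Factor x (u ++ v) →
  Factor x u ⊎ Factor x v ⊎ Σ Word λ s → Σ Word λ p → x ≡ s ++ p × Suffix s u × Prefix p v
factor-++⁻ u v {x} (a , b , eq) with ++-equidivisible u v a (x ++ b) eq
... | inj₁ (t , a≡ut , v≡txb) = inj₂ (inj₁ (t , b , v≡txb))
... | inj₂ (t , u≡at , xb≡tv) with ++-equidivisible x b t v xb≡tv
...   | inj₁ (t′ , t≡xt′ , _) = inj₁ (a , t′ , trans u≡at (cong (a ++_) t≡xt′))
...   | inj₂ (t′ , x≡tt′ , v≡t′b) =
  inj₂ (inj₂ (t , t′ , x≡tt′ , (a , u≡at) , (b , v≡t′b)))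

reverse-factor : ∀ {x w} → Factor x w → Factor (reverse x) (reverse w)
reverse-factor {x} (a , b , refl) = reverse b , reverse a , (begin
  reverse (a ++ x ++ b)                        ≡⟨ reverse-++ a (x ++ b) ⟩
  reverse (x ++ b) ++ reverse a                ≡⟨ cong (_++ reverse a) (reverse-++ x b) ⟩
  (reverse b ++ reverse x) ++ reverse a        ≡⟨ ++-assoc (reverse b) (reverse x) (reverse a) ⟩
  reverse b ++ reverse x ++ reverse a          ∎)
  where open ≡-Reasoning

reverse-prefix : ∀ {p w} → Prefix p w → Suffix (reverse p) (reverse w)
reverse-prefix {p} (c , refl) = reverse c , reverse-++ p c

reverse-suffix : ∀ {s w} → Suffix s w → Prefix (reverse s) (reverse w)
reverse-suffix {s} (r , refl) = reverse r , reverse-++ r s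

length-A : ∀ {n w} → A n w → length w ≡ fib n
length-A a1 = refl
length-A a2 = refl
length-A (aL {u = u} hu hv) = trans (length-++ u) (cong₂ _+_ (length-A hu) (length-A hv))
length-A (aR {n} {u} hu hv) =
  trans (length-++ u) (trans (cong₂ _+_ (length-A hu) (length-A hv)) (+-comm (fib n) (fib (suc n))))

A-inhabited : ∀ n → Σ Word (A (suc n))
A-inhabited zero = _ , a1
A-inhabited (suc zero) = _ , a2
A-inhabited (suc (suc n)) =
  let u , hu = A-inhabited (suc n)
      v , hv = A-inhabited n
  in u ++ v , aL hu hv

A-reverse : ∀ {n w} → A n w → A n (reverse w)
A-reverse a1 = a1
A-reverse a2 = a2
A-reverse (aL {u = u} {v} hu hv) = subst (A _) (sym (reverse-++ u v)) (aR (A-reverse hv) (A-reverse hu))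
A-reverse (aR {u = u} {v} hu hv) = subst (A _) (sym (reverse-++ u v)) (aL (A-reverse hv) (A-reverse hu))

fib-pos : ∀ n → 0 < fib (suc n)
fib-pos zero = s≤s z≤n
fib-pos (suc n) = ≤-trans (fib-pos n) (m≤m+n (fib (suc n)) (fib n))

fib-≤-suc : ∀ n → fib n ≤ fib (suc n)
fib-≤-suc zero = z≤n
fib-≤-suc (suc n) = m≤m+n (fib (suc n)) (fib n)

fib-<-suc : ∀ n → fib (2 + n) < fib (3 + n)
fib-<-suc n = m<m+n (fib (2 + n)) (fib-pos n)

fib-mono : ∀ {m n} → m ≤ n → fib m ≤ fib n
fib-mono m≤n = go (≤⇒≤′ m≤n)
  where
  go : ∀ {m n} → m ≤′ n → fib m ≤ fib n
  go (≤′-reflexive refl) = ≤-refl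
  go {n = suc n} (≤′-step m≤′n) = ≤-trans (go m≤′n) (fib-≤-suc n)

SuffixOfA : ℕ → Word → Set
SuffixOfA n s = Σ Word λ w → A n w × Suffix s w

PrefixOfA : ℕ → Word → Set
PrefixOfA n p = Σ Word λ w → A n w × Prefix p w

FactorOfA : ℕ → Word → Set
FactorOfA n x = Σ Word λ w → A n w × Factor x w

[]-suffixOfA : ∀ n → SuffixOfA (suc n) []
[]-suffixOfA n = let w , hw = A-inhabited n in w , hw , w , sym (++-identityʳ w)

ShortSuffixesDescend : ℕ → Set
ShortSuffixesDescend i = ∀ {s} → length s < fib i → SuffixOfA (suc i) s → SuffixOfA i s

shortSuffixesDescend-step : ∀ m → ShortSuffixesDescend (2 + m) → ShortSuffixesDescend (1 + m) →
  ShortSuffixesDescend (3 + m)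
shortSuffixesDescend-step m _ _ {s} s<f (_ , aR {u = u} {v} hu hv , r , eq)
  with ++-equidivisible u v r s eq
... | inj₁ (t , _ , v≡ts) = v , hv , t , v≡ts
... | inj₂ (t , _ , refl) = ⊥-elim (m+n≮n (length t) (fib (3 + m))
        (subst (_< fib (3 + m)) (trans (length-++ t) (cong (length t +_) (length-A hv))) s<f))
shortSuffixesDescend-step m descend₂ descend₁ {s} s<f (_ , aL {u = u} {v} hu hv , r , eq)
  with ++-equidivisible u v r s eq
... | inj₁ (t , _ , v≡ts) = let z , hz = A-inhabited m in z ++ v , aR hz hv , suffix-++ˡ z (t , v≡ts)
... | inj₂ (t , u≡rt , refl) =
  -- s = t v, and t is short enough to descend twice, into z ∈ A (1 + m); then z v ∈ A (3 + m)
  let z , hz , t-suffix-z =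
        descend₁ t<f₁ (descend₂ (<-≤-trans t<f₁ (fib-≤-suc (1 + m))) (u , hu , r , u≡rt))
  in z ++ v , aR hz hv , suffix-++ʳ v t-suffix-z
  where
  t<f₁ : length t < fib (1 + m)
  t<f₁ = +-cancelˡ-< (fib (2 + m)) (length t) (fib (1 + m)) (subst (_< fib (3 + m))
    (trans (length-++ t) (trans (cong (length t +_) (length-A hv)) (+-comm (length t) _))) s<f)

shortSuffixesDescend : ∀ i → ShortSuffixesDescend i
shortSuffixesDescend (suc zero) {[]} _ _ = []-suffixOfA 0
shortSuffixesDescend (suc (suc zero)) {[]} _ _ = []-suffixOfA 1
shortSuffixesDescend (suc zero) {_ ∷ _} (s≤s ()) _
shortSuffixesDescend (suc (suc zero)) {_ ∷ _} (s≤s ()) _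
shortSuffixesDescend (suc (suc (suc m))) =
  shortSuffixesDescend-step m (shortSuffixesDescend (suc (suc m))) (shortSuffixesDescend (suc m))

shortPrefixesDescend : ∀ i {p} → length p < fib i → PrefixOfA (suc i) p → PrefixOfA i p
shortPrefixesDescend i {p} p<f (w , hw , p-prefix) =
  let z , hz , rp-suffix = shortSuffixesDescend i (subst (_< fib i) (sym (length-reverse p)) p<f)
                             (reverse w , A-reverse hw , reverse-prefix p-prefix)
  in reverse z , A-reverse hz ,
     subst (λ q → Prefix q (reverse z)) (reverse-involutive p) (reverse-suffix rp-suffix)

reverse-factorOfA : ∀ {n x} → FactorOfA n x → FactorOfA n (reverse x)
reverse-factorOfA (w , hw , fx) = reverse w , A-reverse hw , reverse-factor fx

reverse-factorOfA⁻ : ∀ {n x} → FactorOfA n (reverse x) → FactorOfA n x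
reverse-factorOfA⁻ {n} {x} = subst (FactorOfA n) (reverse-involutive x) ∘ reverse-factorOfA

straddling-factorOfA : ∀ m {u v s p} → length s + length p ≤ fib (4 + m) →
  A (5 + m) u → A (4 + m) v → Suffix s u → Prefix p v → FactorOfA (5 + m) (s ++ p)
straddling-factorOfA m {u} {s = s} {[]} _ hu _ s-suffix _ =
  u , hu , subst (λ y → Factor y u) (sym (++-identityʳ s)) (suffix⇒factor s-suffix)
straddling-factorOfA m {u} {v} {s} {p@(_ ∷ _)} ℓ hu hv s-suffix p-prefix
  with length s <? fib (3 + m)
... | yes s<f₃ =
  let z , hz , s-suffix-z = shortSuffixesDescend (3 + m) s<f₃
        (shortSuffixesDescend (4 + m) (<-≤-trans s<f₃ (fib-≤-suc (3 + m))) (u , hu , s-suffix))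
  in z ++ v , aR hz hv , factor-join s-suffix-z p-prefix
... | no s≮f₃ =
  let z , hz , s-suffix-z = shortSuffixesDescend (4 + m) s<f₄ (u , hu , s-suffix)
      y , hy , p-prefix-y = shortPrefixesDescend (3 + m) p<f₃ (v , hv , p-prefix)
  in z ++ y , aL hz hy , factor-join s-suffix-z p-prefix-y
  where
  s<f₄ : length s < fib (4 + m)
  s<f₄ = m+n≤o⇒m≤o (suc (length s)) (subst (_≤ fib (4 + m)) (+-suc (length s) _) ℓ)
  p≤f₂ : length p ≤ fib (2 + m)
  p≤f₂ = +-cancelˡ-≤ (fib (3 + m)) (length p) (fib (2 + m))
           (≤-trans (+-monoˡ-≤ (length p) (≮⇒≥ s≮f₃)) ℓ)
  p<f₃ : length p < fib (3 + m)
  p<f₃ = ≤-<-trans p≤f₂ (fib-<-suc m)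

factorOfA-++-pred : ∀ m {u v x} → length x ≤ fib (4 + m) → A (5 + m) u → A (4 + m) v →
  Factor x (u ++ v) → FactorOfA (5 + m) x
factorOfA-++-pred m {u} {v} ℓ hu hv fx with factor-++⁻ u v fx
... | inj₁ fu = u , hu , fu
... | inj₂ (inj₁ fv) = let z , hz = A-inhabited (2 + m) in v ++ z , aL hv hz , factor-++ʳ z fv
... | inj₂ (inj₂ (s , p , refl , s-suffix , p-prefix)) =
  straddling-factorOfA m (subst (_≤ fib (4 + m)) (length-++ s) ℓ) hu hv s-suffix p-prefix

factorOfA-pred : ∀ {n x} → 4 ≤ n → length x ≤ fib n → FactorOfA (2 + n) x → FactorOfA (1 + n) x
factorOfA-pred (s≤s (s≤s (s≤s (s≤s {n = m} z≤n)))) ℓ (_ , aL hu hv , fx) =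
  factorOfA-++-pred m ℓ hu hv fx
factorOfA-pred {x = x} (s≤s (s≤s (s≤s (s≤s {n = m} z≤n)))) ℓ (_ , aR {u = u} {v} hu hv , fx) =
  reverse-factorOfA⁻ (factorOfA-++-pred m (subst (_≤ fib (4 + m)) (sym (length-reverse x)) ℓ)
    (A-reverse hv) (A-reverse hu) (subst (Factor (reverse x)) (reverse-++ u v) (reverse-factor fx)))

factorOfA-suc : ∀ {n x} → 1 ≤ n → FactorOfA (1 + n) x → FactorOfA (2 + n) x
factorOfA-suc {suc n} _ (w , hw , fx) =
  let z , hz = A-inhabited n in w ++ z , aL hw hz , factor-++ʳ z fx

factorOfA-ascend : ∀ {n n′ x} → 1 ≤ n → n ≤ n′ → FactorOfA (suc n) x → FactorOfA (suc n′) x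
factorOfA-ascend {n} 1≤n n≤n′ = go (≤⇒≤′ n≤n′)
  where
  go : ∀ {n′ x} → n ≤′ n′ → FactorOfA (suc n) x → FactorOfA (suc n′) x
  go (≤′-reflexive refl) fx = fx
  go (≤′-step n≤′n′) fx = factorOfA-suc (≤-trans 1≤n (≤′⇒≤ n≤′n′)) (go n≤′n′ fx)

factorOfA-descend : ∀ {n n′ x} → 4 ≤ n → n ≤ n′ → length x ≤ fib n →
  FactorOfA (suc n′) x → FactorOfA (suc n) x
factorOfA-descend {n} {x = x} 4≤n n≤n′ ℓ = go (≤⇒≤′ n≤n′)
  where
  go : ∀ {n′} → n ≤′ n′ → FactorOfA (suc n′) x → FactorOfA (suc n) x
  go (≤′-reflexive refl) fx = fx
  go (≤′-step n≤′n′) fx = let n≤n′ = ≤′⇒≤ n≤′n′ in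
    go n≤′n′ (factorOfA-pred (≤-trans 4≤n n≤n′) (≤-trans ℓ (fib-mono n≤n′)) fx)

proposition7 : ∀ (k n : ℕ) → 1 ≤ k → 4 ≤ n →
    F (A (n + 1)) (fib n) ≐ F (A (n + k)) (fib n)
proposition7 (suc d) n _ 4≤n rewrite +-comm n 1 | +-suc n d =
  (λ _ (ℓ , fx) → ℓ , factorOfA-ascend (≤-trans (s≤s z≤n) 4≤n) (m≤m+n n d) fx) ,
  (λ _ (ℓ , fx) → ℓ , factorOfA-descend 4≤n (m≤m+n n d) (≤-reflexive ℓ) fx)
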